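{- Let $\mathbb{F}$ be a field with $|\mathbb{F}| > n^2$. There exists an explicit polynomial map $P : \mathbb{F}^{4\varepsilon n^2} \to \mathbb{F}^{n\times n}$, each of whose coordinates is a polynomial of degree at most $n^2$, such that every matrix $M \in \mathbb{F}^{n\times n}$ which is not $(\varepsilon n, \varepsilon n^2)$-rigid lies in the image of $P$.
   Context: Here $\varepsilon > 0$ is such that $\varepsilon n$ and $\varepsilon n^2$ are integers. A matrix $M \in \mathbb{F}^{n\times n}$ is $(r,s)$-rigid if $M$ cannot be written as $M = R + S$ with $\mathrm{rank}(R) \le r$ and $S$ having at most $s$ non-zero entries. -}

module Defs where

open import Level using (Level; _⊔_; suc)
open import Algebra.Bundles using (CommutativeRing)
open import Data.Nat using (ℕ; _≤_) renaming (_+_ to _+ℕ_; suc to sucℕ; _⊔_ to _⊔ℕ_; zero to zeroℕ)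
import Data.Fin
open Data.Fin using (Fin)
open import Data.Product using (Σ; ∃; _×_; _,_)
open import Data.List using (List; length)
open import Data.List.Membership.Propositional using (_∈_)
open import Relation.Nullary using (¬_)
open import Relation.Binary.PropositionalEquality using (_≡_)

record Field (c ℓ : Level) : Set (Level.suc (c ⊔ ℓ)) where
  field
    commutativeRing : CommutativeRing c ℓ
  open CommutativeRing commutativeRing public
  field
    0≉1     : ¬ (0# ≈ 1#)
    inverse : ∀ x → ¬ (x ≈ 0#) → Σ Carrier (λ y → (x * y) ≈ 1#)

module _ {c ℓ} (F : Field c ℓ) where
  open Field F

  -- |F| > m : there are m+1 pairwise distinct elements of F.
  CardGt : ℕ → Set (c ⊔ ℓ)
  CardGt m = Σ (Fin (sucℕ m) → Carrier) (λ f → ∀ i j → f i ≈ f j → i ≡ j)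

  data Poly (m : ℕ) : Set c where
    var  : Fin m → Poly m
    con  : Carrier → Poly m
    _⊕_  : Poly m → Poly m → Poly m
    _⊗_  : Poly m → Poly m → Poly m

  -- (Syntactic) total degree.
  deg : ∀ {m} → Poly m → ℕ
  deg (var _) = 1
  deg (con _) = 0
  deg (p ⊕ q) = deg p ⊔ℕ deg q
  deg (p ⊗ q) = deg p +ℕ deg q

  eval : ∀ {m} → Poly m → (Fin m → Carrier) → Carrier
  eval (var i) x = x i
  eval (con a) x = a
  eval (p ⊕ q) x = eval p x + eval q x
  eval (p ⊗ q) x = eval p x * eval q x

  Mat : ℕ → Set c
  Mat n = Fin n → Fin n → Carrier

  Σᶠ : ∀ r → (Fin r → Carrier) → Carrier
  Σᶠ zeroℕ    f = 0#
  Σᶠ (sucℕ r)  f = f Data.Fin.zero + Σᶠ r (λ i → f (Data.Fin.suc i))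

  -- rank(R) ≤ r : the column space of R is spanned by r vectors u_0,…,u_{r-1},
  -- i.e. every column of R is a linear combination of them.
  RankAtMost : ∀ {n} → ℕ → Mat n → Set (c ⊔ ℓ)
  RankAtMost {n} r R =
    Σ (Fin r → Fin n → Carrier) λ u →
      ∀ (j : Fin n) → Σ (Fin r → Carrier) λ a →
        ∀ (i : Fin n) → R i j ≈ Σᶠ r (λ t → a t * u t i)

  SparsityAtMost : ∀ {n} → ℕ → Mat n → Set ℓ
  SparsityAtMost {n} s S =
    Σ (List (Fin n × Fin n)) λ T →
      (length T ≤ s) × (∀ i j → ¬ ((i , j) ∈ T) → S i j ≈ 0#)

  NotRigid : ∀ {n} → ℕ → ℕ → Mat n → Set (c ⊔ ℓ)
  NotRigid {n} r s M =
    Σ (Mat n) λ R → Σ (Mat n) λ S →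
      RankAtMost r R × SparsityAtMost s S × (∀ i j → M i j ≈ R i j + S i j)

  Rigid : ∀ {n} → ℕ → ℕ → Mat n → Set (c ⊔ ℓ)
  Rigid r s M = ¬ NotRigid r s M

-- If M = R + S with rank R ≤ k and S supported on at most K = k·n entries, then
--   M i j = Σ_{t<k} a_j(t)·u_t(i)  +  Σ_{s<K} v_s · δ_{(i,j)}(y_s),
-- where u_0,…,u_{k-1} span the columns of R, a_j are the coefficients of column j,
-- the K "slots" (v_s, y_s) list the nonzero entries of S (value v_s, position
-- encoded as a field element y_s), and δ_{(i,j)} is the Lagrange polynomial that
-- is 1 at the point encoding (i,j) and 0 at the n²−1 points encoding the other
-- positions; here |F| > n² provides n² distinct points.  Reading u, a, v, y as
-- 4K variables gives the polynomial map P; each entry has degree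
-- max(2, 1 + (n²−1)) = n² when n ≥ 2, while for n = 1 the map x ↦ x₀ suffices.
module Submission where

open import Defs
open import Data.Nat using (ℕ; _≤_; _*_)
open import Data.Fin using (Fin)
open import Data.Product using (Σ; _×_)

open import Data.Nat using (zero; suc; pred; z≤n; s≤s; s≤s⁻¹)
open import Data.Nat.Properties using (⊔-lub; ≤-refl; ≤-trans; ≤-reflexive)
open import Data.Fin using (zero; suc; combine; remQuot; inject₁; punchIn; punchOut)
open import Data.Fin.Properties using (remQuot-combine; combine-injective; punchInᵢ≢i; punchIn-punchOut; inject₁-injective)
  renaming (_≟_ to _≟ᶠ_)
open import Data.Product using (_,_; proj₁; proj₂; uncurry)
open import Data.Product.Properties using (≡-dec)
open import Data.Maybe using (Maybe; just; nothing; maybe; fromMaybe)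
open import Data.List using (List; []; _∷_; length; deduplicate)
open import Data.List.Properties using (length-deduplicate)
open import Data.List.Membership.Propositional using (_∈_; _∉_)
open import Data.List.Membership.Propositional.Properties using (∈-deduplicate⁺; ∈-deduplicate⁻)
open import Data.List.Relation.Unary.Any using (here; there)
open import Data.List.Relation.Unary.All using (lookup)
open import Data.List.Relation.Unary.Unique.Propositional using (Unique; _∷_)
open import Data.List.Relation.Unary.Unique.DecPropositional.Properties using (deduplicate-!)
open import Function using (_∘_)
open import Relation.Nullary using (¬_; yes; no)
open import Relation.Binary.Definitions using (DecidableEquality)
open import Relation.Binary.PropositionalEquality using (_≡_; _≢_; refl; cong; ≢-sym)
  renaming (trans to ≡-trans)
import Data.List.Membership.DecPropositional as DecMembership
import Algebra.Properties.Group as GroupProperties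

uncurryᶠ : ∀ {a b ℓ} {A : Set ℓ} → (Fin a → Fin b → A) → Fin (a * b) → A
uncurryᶠ {b = b} f w = uncurry f (remQuot b w)

uncurryᶠ-combine : ∀ {a b ℓ} {A : Set ℓ} (f : Fin a → Fin b → A) i j →
                   uncurryᶠ f (combine i j) ≡ f i j
uncurryᶠ-combine f i j = cong (uncurry f) (remQuot-combine i j)

module Construction {c ℓ} (𝔽 : Field c ℓ) where
  open Field 𝔽 hiding (zero) renaming (_*_ to _·_; refl to ≈-refl)
  open GroupProperties +-group using (x∙y⁻¹≈ε⇒x≈y)
  open import Relation.Binary.Reasoning.Setoid setoid

  *-≉0 : ∀ {x y} → ¬ (x ≈ 0#) → ¬ (y ≈ 0#) → ¬ ((x · y) ≈ 0#)
  *-≉0 {x} {y} x≉0 y≉0 xy≈0 = y≉0 (begin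
    y              ≈⟨ *-identityˡ y ⟨
    1# · y         ≈⟨ *-cong (trans (sym xx⁻¹≈1) (*-comm x x⁻¹)) ≈-refl ⟩
    (x⁻¹ · x) · y  ≈⟨ *-assoc x⁻¹ x y ⟩
    x⁻¹ · (x · y)  ≈⟨ *-cong ≈-refl xy≈0 ⟩
    x⁻¹ · 0#       ≈⟨ zeroʳ x⁻¹ ⟩
    0#             ∎)
    where
    x⁻¹ : Carrier
    x⁻¹ = proj₁ (inverse x x≉0)
    xx⁻¹≈1 : (x · x⁻¹) ≈ 1#
    xx⁻¹≈1 = proj₂ (inverse x x≉0)

  Πᶠ : ∀ r → (Fin r → Carrier) → Carrier
  Πᶠ zero    f = 1#
  Πᶠ (suc r) f = f zero · Πᶠ r (f ∘ suc)

  Πᶠ-zero : ∀ r (f : Fin r → Carrier) q → f q ≈ 0# → Πᶠ r f ≈ 0#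
  Πᶠ-zero (suc r) f zero    fq≈0 = trans (*-cong fq≈0 ≈-refl) (zeroˡ _)
  Πᶠ-zero (suc r) f (suc q) fq≈0 = trans (*-cong ≈-refl (Πᶠ-zero r (f ∘ suc) q fq≈0)) (zeroʳ _)

  Πᶠ-≉0 : ∀ r (f : Fin r → Carrier) → (∀ q → ¬ (f q ≈ 0#)) → ¬ (Πᶠ r f ≈ 0#)
  Πᶠ-≉0 zero    f f≉0 1≈0 = 0≉1 (sym 1≈0)
  Πᶠ-≉0 (suc r) f f≉0     = *-≉0 (f≉0 zero) (Πᶠ-≉0 r (f ∘ suc) (f≉0 ∘ suc))

  Σᶠ-cong : ∀ r {f g : Fin r → Carrier} → (∀ t → f t ≈ g t) → Σᶠ 𝔽 r f ≈ Σᶠ 𝔽 r g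
  Σᶠ-cong zero    f≈g = ≈-refl
  Σᶠ-cong (suc r) f≈g = +-cong (f≈g zero) (Σᶠ-cong r (f≈g ∘ suc))

  Σᶠ-zero : ∀ r (f : Fin r → Carrier) → (∀ t → f t ≈ 0#) → Σᶠ 𝔽 r f ≈ 0#
  Σᶠ-zero zero    f f≈0 = ≈-refl
  Σᶠ-zero (suc r) f f≈0 = trans (+-cong (f≈0 zero) (Σᶠ-zero r (f ∘ suc) (f≈0 ∘ suc))) (+-identityˡ 0#)

  Σˡ : ∀ {a} {A : Set a} → (A → Carrier) → List A → Carrier
  Σˡ f []       = 0#
  Σˡ f (q ∷ qs) = f q + Σˡ f qs

  Σᵖ : ∀ {N} r → (Fin r → Poly 𝔽 N) → Poly 𝔽 N
  Σᵖ zero    f = con 0#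
  Σᵖ (suc r) f = f zero ⊕ Σᵖ r (f ∘ suc)

  Πᵖ : ∀ {N} r → (Fin r → Poly 𝔽 N) → Poly 𝔽 N
  Πᵖ zero    f = con 1#
  Πᵖ (suc r) f = f zero ⊗ Πᵖ r (f ∘ suc)

  eval-Σᵖ : ∀ {N} r (f : Fin r → Poly 𝔽 N) x → eval 𝔽 (Σᵖ r f) x ≈ Σᶠ 𝔽 r (λ t → eval 𝔽 (f t) x)
  eval-Σᵖ zero    f x = ≈-refl
  eval-Σᵖ (suc r) f x = +-cong ≈-refl (eval-Σᵖ r (f ∘ suc) x)

  eval-Πᵖ : ∀ {N} r (f : Fin r → Poly 𝔽 N) x → eval 𝔽 (Πᵖ r f) x ≈ Πᶠ r (λ t → eval 𝔽 (f t) x)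
  eval-Πᵖ zero    f x = ≈-refl
  eval-Πᵖ (suc r) f x = *-cong ≈-refl (eval-Πᵖ r (f ∘ suc) x)

  deg-Σᵖ : ∀ {N} r (f : Fin r → Poly 𝔽 N) {B} → (∀ t → deg 𝔽 (f t) ≤ B) → deg 𝔽 (Σᵖ r f) ≤ B
  deg-Σᵖ zero    f deg-f≤B = z≤n
  deg-Σᵖ (suc r) f deg-f≤B = ⊔-lub (deg-f≤B zero) (deg-Σᵖ r (f ∘ suc) (deg-f≤B ∘ suc))

  deg-Π-linear : ∀ {N} (v : Fin N) r (b : Fin r → Carrier) →
                 deg 𝔽 (Πᵖ r (λ q → var v ⊕ con (b q))) ≡ r
  deg-Π-linear v zero    b = refl
  deg-Π-linear v (suc r) b = cong suc (deg-Π-linear v r (b ∘ suc))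

  module Lagrange (m : ℕ) (pt : Fin (suc m) → Carrier)
                  (pt-injective : ∀ {p q} → pt p ≈ pt q → p ≡ q) where

    -- ∏_{q ≠ p} (y − pt q), the q ≠ p being enumerated as punchIn p.
    vanishing : Fin (suc m) → Carrier → Carrier
    vanishing p y = Πᶠ m (λ q → y + - pt (punchIn p q))

    vanishing-≉0 : ∀ p → ¬ (vanishing p (pt p) ≈ 0#)
    vanishing-≉0 p = Πᶠ-≉0 m _ λ q pp-pq≈0 →
      punchInᵢ≢i p q (pt-injective (sym (x∙y⁻¹≈ε⇒x≈y _ _ pp-pq≈0)))

    normaliser : Fin (suc m) → Carrier
    normaliser p = proj₁ (inverse _ (vanishing-≉0 p))

    lagrange : Fin (suc m) → Carrier → Carrier
    lagrange p y = normaliser p · vanishing p y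

    lagrangeᵖ : ∀ {N} → Fin (suc m) → Fin N → Poly 𝔽 N
    lagrangeᵖ p v = con (normaliser p) ⊗ Πᵖ m (λ q → var v ⊕ con (- pt (punchIn p q)))

    eval-lagrangeᵖ : ∀ {N} p (v : Fin N) x → eval 𝔽 (lagrangeᵖ p v) x ≈ lagrange p (x v)
    eval-lagrangeᵖ p v x = *-cong ≈-refl (eval-Πᵖ m _ x)

    deg-lagrangeᵖ : ∀ {N} p (v : Fin N) → deg 𝔽 (lagrangeᵖ p v) ≡ m
    deg-lagrangeᵖ p v = deg-Π-linear v m _

    lagrange-same : ∀ p → lagrange p (pt p) ≈ 1#
    lagrange-same p = trans (*-comm _ _) (proj₂ (inverse _ (vanishing-≉0 p)))

    -- At another point q the factor y − pt q (index punchOut) vanishes.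
    lagrange-other : ∀ {p q} → q ≢ p → lagrange p (pt q) ≈ 0#
    lagrange-other {p} {q} q≢p = trans (*-cong ≈-refl vanishes) (zeroʳ _)
      where
      vanishes : vanishing p (pt q) ≈ 0#
      vanishes = Πᶠ-zero m _ (punchOut (≢-sym q≢p))
        (trans (+-cong ≈-refl (-‿cong (reflexive (cong pt (punchIn-punchOut (≢-sym q≢p))))))
               (-‿inverseʳ _))

  -- A function supported on a list of at most m points of A is a weighted sum
  -- of m point indicators: slot t carries a value and a position.
  module Sparse {a} {A : Set a} (_≟_ : DecidableEquality A) (default : A) where

    slot : ∀ m → List A → Fin m → Maybe A
    slot (suc m) []       t       = nothing
    slot (suc m) (q ∷ qs) zero    = just q
    slot (suc m) (q ∷ qs) (suc t) = slot m qs t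

    Σᶠ-slot : ∀ (h : Maybe A → Carrier) → h nothing ≈ 0# → ∀ m qs → length qs ≤ m →
              Σᶠ 𝔽 m (h ∘ slot m qs) ≈ Σˡ (h ∘ just) qs
    Σᶠ-slot h h-nothing zero    []       _      = ≈-refl
    Σᶠ-slot h h-nothing zero    (q ∷ qs) ()
    Σᶠ-slot h h-nothing (suc m) []       _      = Σᶠ-zero (suc m) _ (λ _ → h-nothing)
    Σᶠ-slot h h-nothing (suc m) (q ∷ qs) |qs|≤m =
      +-cong ≈-refl (Σᶠ-slot h h-nothing m qs (s≤s⁻¹ |qs|≤m))

    module Indicator (S : A → Carrier) {p : A} {G : A → Carrier}
                     (G-p : G p ≈ 1#) (G-other : ∀ {q} → q ≢ p → G q ≈ 0#) where

      Σˡ-∉ : ∀ {qs} → p ∉ qs → Σˡ (λ q → S q · G q) qs ≈ 0#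
      Σˡ-∉ {[]}     p∉qs = ≈-refl
      Σˡ-∉ {q ∷ qs} p∉qs = trans
        (+-cong (trans (*-cong ≈-refl (G-other λ { refl → p∉qs (here refl) })) (zeroʳ _))
                (Σˡ-∉ (p∉qs ∘ there)))
        (+-identityˡ 0#)

      Σˡ-∈ : ∀ {qs} → Unique qs → p ∈ qs → Σˡ (λ q → S q · G q) qs ≈ S p
      Σˡ-∈ (q≢rest ∷ _) (here refl) = trans
        (+-cong (trans (*-cong ≈-refl G-p) (*-identityʳ _)) (Σˡ-∉ λ p∈qs → lookup q≢rest p∈qs refl))
        (+-identityʳ _)
      Σˡ-∈ (q≢rest ∷ unique) (there p∈qs) = trans
        (+-cong (trans (*-cong ≈-refl (G-other (lookup q≢rest p∈qs))) (zeroʳ _)) (Σˡ-∈ unique p∈qs))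
        (+-identityˡ _)

    -- Slot t of the encoding of a list T: its t-th distinct element and the
    -- value of S there (value 0 for unused slots).
    sparseSlot : ∀ m → List A → Fin m → Maybe A
    sparseSlot m T = slot m (deduplicate _≟_ T)

    sparseValue : (A → Carrier) → ∀ m → List A → Fin m → Carrier
    sparseValue S m T = maybe S 0# ∘ sparseSlot m T

    sparsePosition : ∀ m → List A → Fin m → A
    sparsePosition m T = fromMaybe default ∘ sparseSlot m T

    sparse-decomposition :
      ∀ (S : A → Carrier) m T → length T ≤ m → (∀ q → q ∉ T → S q ≈ 0#) →
      ∀ {p} {G : A → Carrier} → G p ≈ 1# → (∀ {q} → q ≢ p → G q ≈ 0#) →
      Σᶠ 𝔽 m (λ t → sparseValue S m T t · G (sparsePosition m T t)) ≈ S p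
    sparse-decomposition S m T |T|≤m S-off {p} {G} G-p G-other = begin
      Σᶠ 𝔽 m (term ∘ slot m qs)  ≈⟨ Σᶠ-slot term (zeroˡ _) m qs (≤-trans (length-deduplicate _≟_ T) |T|≤m) ⟩
      Σˡ (λ q → S q · G q) qs    ≈⟨ by-membership ⟩
      S p                        ∎
      where
      open Indicator S G-p G-other
      qs : List A
      qs = deduplicate _≟_ T
      term : Maybe A → Carrier
      term o = maybe S 0# o · G (fromMaybe default o)
      by-membership : Σˡ (λ q → S q · G q) qs ≈ S p
      by-membership with DecMembership._∈?_ _≟_ p T
      ... | yes p∈T = Σˡ-∈ (deduplicate-! _≟_ T) (∈-deduplicate⁺ _≟_ p∈T)
      ... | no  p∉T = trans (Σˡ-∉ (p∉T ∘ ∈-deduplicate⁻ _≟_ T)) (sym (S-off p p∉T))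

  module Main (n₀ k : ℕ) (pt : Fin (suc n₀ * suc n₀) → Carrier)
              (pt-injective : ∀ {p q} → pt p ≈ pt q → p ≡ q) where

    n K N : ℕ
    n = suc n₀
    K = k * n
    N = 4 * K

    Pos : Set
    Pos = Fin n × Fin n

    -- Matrix positions, numbered by the n² Lagrange points.
    code : Pos → Fin (n * n)
    code = uncurry combine

    code-injective : ∀ {p q} → code p ≡ code q → p ≡ q
    code-injective {i , j} {i' , j'} eq with combine-injective i j i' j' eq
    ... | refl , refl = refl

    open Lagrange (pred (n * n)) pt pt-injective
    open Sparse {A = Pos} (≡-dec _≟ᶠ_ _≟ᶠ_) (zero , zero)

    uVar aVar : Fin k → Fin n → Fin N
    uVar t i = combine {4} zero (combine t i)
    aVar t j = combine {4} (suc zero) (combine t j)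

    valueVar positionVar : Fin K → Fin N
    valueVar    = combine {4} (suc (suc zero))
    positionVar = combine {4} (suc (suc (suc zero)))

    lowRankᵖ sparseᵖ P : Fin n → Fin n → Poly 𝔽 N
    lowRankᵖ i j = Σᵖ k (λ t → var (aVar t j) ⊗ var (uVar t i))
    sparseᵖ i j = Σᵖ K (λ s → var (valueVar s) ⊗ lagrangeᵖ (code (i , j)) (positionVar s))
    P i j = lowRankᵖ i j ⊕ sparseᵖ i j

    -- The low-rank part has degree 2 and the sparse part degree 1 + (n² − 1).
    deg-P : 2 ≤ n * n → ∀ i j → deg 𝔽 (P i j) ≤ n * n
    deg-P 2≤n² i j = ⊔-lub
      (deg-Σᵖ k _ (λ _ → 2≤n²))
      (deg-Σᵖ K _ (λ s → ≤-reflexive (cong suc (deg-lagrangeᵖ (code (i , j)) (positionVar s)))))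

    P-onto : ∀ (M : Mat 𝔽 n) → NotRigid 𝔽 k K M →
             Σ (Fin N → Carrier) λ x → ∀ i j → eval 𝔽 (P i j) x ≈ M i j
    P-onto M (R , S , (u , coefficients) , (T , |T|≤K , S-off) , M≈R+S) = x , λ i j → begin
      eval 𝔽 (P i j) x  ≈⟨ +-cong (lowRank-value i j) (sparse-value i j) ⟩
      R i j + S i j     ≈⟨ sym (M≈R+S i j) ⟩
      M i j             ∎
      where
      a : Fin k → Fin n → Carrier
      a t j = proj₁ (coefficients j) t

      S′ : Pos → Carrier
      S′ = uncurry S

      block : Fin 4 → Fin K → Carrier
      block zero                   = uncurryᶠ u
      block (suc zero)             = uncurryᶠ a
      block (suc (suc zero))       = sparseValue S′ K T
      block (suc (suc (suc zero))) = pt ∘ code ∘ sparsePosition K T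

      x : Fin N → Carrier
      x = uncurryᶠ block

      x-block : ∀ b s → x (combine {4} b s) ≡ block b s
      x-block = uncurryᶠ-combine block

      x-uVar : ∀ t i → x (uVar t i) ≡ u t i
      x-uVar t i = ≡-trans (x-block zero (combine t i)) (uncurryᶠ-combine u t i)

      x-aVar : ∀ t j → x (aVar t j) ≡ a t j
      x-aVar t j = ≡-trans (x-block (suc zero) (combine t j)) (uncurryᶠ-combine a t j)

      lowRank-value : ∀ i j → eval 𝔽 (lowRankᵖ i j) x ≈ R i j
      lowRank-value i j = begin
        eval 𝔽 (lowRankᵖ i j) x         ≈⟨ eval-Σᵖ k _ x ⟩
        Σᶠ 𝔽 k (λ t → x (aVar t j) · x (uVar t i))
          ≈⟨ Σᶠ-cong k (λ t → *-cong (reflexive (x-aVar t j)) (reflexive (x-uVar t i))) ⟩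
        Σᶠ 𝔽 k (λ t → a t j · u t i)     ≈⟨ proj₂ (coefficients j) i ⟨
        R i j                           ∎

      sparse-value : ∀ i j → eval 𝔽 (sparseᵖ i j) x ≈ S i j
      sparse-value i j = begin
        eval 𝔽 (sparseᵖ i j) x
          ≈⟨ eval-Σᵖ K _ x ⟩
        Σᶠ 𝔽 K (λ s → x (valueVar s) · eval 𝔽 (lagrangeᵖ (code (i , j)) (positionVar s)) x)
          ≈⟨ Σᶠ-cong K (λ s → *-cong (reflexive (x-block (suc (suc zero)) s)) (eval-lagrangeᵖ-slot s)) ⟩
        Σᶠ 𝔽 K (λ s → sparseValue S′ K T s · lagrange (code (i , j)) (pt (code (sparsePosition K T s))))
          ≈⟨ sparse-decomposition S′ K T |T|≤K (λ (i′ , j′) → S-off i′ j′)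
               (lagrange-same (code (i , j))) (λ q≢ij → lagrange-other (q≢ij ∘ code-injective)) ⟩
        S i j
          ∎
        where
        eval-lagrangeᵖ-slot : ∀ s → eval 𝔽 (lagrangeᵖ (code (i , j)) (positionVar s)) x
                                    ≈ lagrange (code (i , j)) (pt (code (sparsePosition K T s)))
        eval-lagrangeᵖ-slot s = trans (eval-lagrangeᵖ (code (i , j)) (positionVar s) x)
                                      (reflexive (cong (lagrange (code (i , j))) (x-block (suc (suc (suc zero))) s)))

lemma2p2 : ∀ {c ℓ} (F : Field c ℓ) (n k : ℕ) → 1 ≤ n → 1 ≤ k → CardGt F (n * n) →
    Σ (Fin n → Fin n → Poly F (4 * (k * n))) λ P →
      (∀ i j → deg F (P i j) ≤ n * n) ×
      (∀ (M : Mat F n) → NotRigid F k (k * n) M →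
        Σ (Fin (4 * (k * n)) → Field.Carrier F) λ x →
          ∀ i j → Field._≈_ F (eval F (P i j) x) (M i j))
lemma2p2 F (suc zero) (suc k) _ _ _ =
  (λ _ _ → var zero) , (λ _ _ → ≤-refl) ,
  λ M _ → (λ _ → M zero zero) , λ { zero zero → Field.refl F }
lemma2p2 F (suc (suc n₀)) k _ _ (points , points-injective) =
  P , deg-P (s≤s (s≤s z≤n)) , P-onto
  where
  open Construction.Main F (suc n₀) k (points ∘ inject₁)
    (inject₁-injective ∘ points-injective _ _)
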